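{- Let $\mathcal{R}$ be an LCSTRS with a sort ordering $\succsim$, and let $\mathbb{C}$ be the RC-set described below. Then every function symbol $f\in\mathcal{F}$ that is not a defined symbol of $\mathcal{R}$ is $\mathbb{C}$-computable.
   Context: LCSTRSs. Fix sorts $\mathcal{S}$ with theory sorts $\mathcal{S}_{\mathrm{th}}$; types $\mathcal{T}::=\mathcal{S}\mid(\mathcal{T}\to\mathcal{T})$. Terms are well-typed applicative expressions over typed function symbols $\mathcal{F}$ and variables; $\mathrm{FV}(t)$ is the set of variables. Theory symbols $\mathcal{F}_{\mathrm{th}}\subseteq\mathcal{F}$ have types $S_1\to\cdots\to S_k$ with all $S_i\in\mathcal{S}_{\mathrm{th}}$; those of sort type are values; theory terms are built from theory symbols and variables. Theory symbols are interpreted by $[\![\cdot]\!]$ in sets $\mathfrak{X}_A$ (bijectively on values), extended to ground theory terms; $\mathsf{bool}\in\mathcal{S}_{\mathrm{th}}$, $\mathfrak{t},\mathfrak{f}\mapsto1,0$. A logical constraint is a $\mathsf{bool}$-typed theory term with theory-sorted variables. A rule $\ell\to r\ [\varphi]$ has $\ell=f\,t_1\cdots t_n$ a pattern (all subterms variables or symbol-headed applications) containing a non-theory symbol, $r$ of the same type, $\varphi$ a logical constraint, theory-sorted variables in $\mathrm{FV}(r)\setminus\mathrm{FV}(\ell)$; it rewrites $C[\ell\sigma]\to_{\mathcal{R}}C[r\sigma]$ in any context $C$ when $\sigma$ maps $\mathrm{FV}(\varphi)\cup(\mathrm{FV}(r)\setminus\mathrm{FV}(\ell))$ to values and $[\![\varphi\sigma]\!]=1$;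 $\to_{\mathcal{R}}$ also contains calculation steps $C[f\,v_1\cdots v_n]\to C[v']$ ($f$ theory symbol, $n>0$, values, $[\![f\,v_1\cdots v_n]\!]=[\![v']\!]$). $f$ is a defined symbol of $\mathcal{R}$ if some rule of $\mathcal{R}$ has left-hand side of the form $f\,t_1\cdots t_n$. A sort ordering is a quasi-order $\succsim$ on $\mathcal{S}$ whose strict part $\succ$ is well-founded. For a sort $A$ and $B=B_1\to\cdots\to B_n\to C$ ($C$ sort): $A\succsim_+B$ iff $A\succsim C$ and $A\succ_-B_i$ for all $i$; $A\succ_-B$ iff $A\succ C$ and $A\succsim_+B_i$ for all $i$. For $f:A_1\to\cdots\to A_n\to B$ ($B$ sort), $\mathrm{Acc}(f)=\{i:B\succsim_+A_i\}$. A neutral term has the form $x\,t_1\cdots t_n$ with $x$ a variable. An RC-set is a sort-indexed family $(I_A)$ where each $I_A$ consists of terminating terms of type $A$, is closed under $\to_{\mathcal{R}}$, and contains each neutral term of type $A$ all of whose one-step reducts lie in $I_A$. A term $t$ is $I$-computable if its type is a sort and $t\in I$, or its type is $A\to B$ and $t\,u$ is $I$-computable for every $I$-computable $u:A$. $s\Rrightarrow_It$ iff $s,t$ have base type, $s=f\,s_1\cdots s_m$ with $f\in\mathcal{F}$, and $t=s_k\,t_1\cdots t_n$ with $k\in\mathrm{Acc}(f)$ and all $t_i$ $I$-computable. $\mathbb{C}$ is the (known to exist) RC-set such that $t\in\mathbb{C}_A$ iff $t:A$ is terminating w.r.t. $\to_{\mathcal{R}}\cup\Rrightarrow_{\mathbb{C}}$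 and for every $t'$ with $t\to_{\mathcal{R}}^*t'$ and $t'=f\,t_1\cdots t_n$ ($f\in\mathcal{F}$), $t_i$ is $\mathbb{C}$-computable for all $i\in\mathrm{Acc}(f)$. -}

module Defs where

open import Data.Nat using (ℕ; zero; suc)
open import Data.Fin using (Fin; toℕ)
open import Data.List using (List; []; _∷_; _++_; [_]; length; lookup)
open import Data.Maybe using (Maybe; just; nothing)
open import Data.Product using (Σ; _×_; _,_; ∃; ∃-syntax; proj₁; proj₂)
open import Data.Sum using (_⊎_)
open import Data.Empty using (⊥)
open import Relation.Nullary using (¬_)
open import Relation.Binary.PropositionalEquality using (_≡_; _≢_; subst)
open import Relation.Binary.Structures using (IsPreorder)
open import Relation.Binary.Construct.Closure.ReflexiveTransitive using (Star)
open import Induction.WellFounded using (WellFounded; Acc)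
open import Function.Bundles using (_⇔_)

infixr 5 _⇒_
data Ty (S : Set) : Set where
  ι   : S → Ty S
  _⇒_ : Ty S → Ty S → Ty S

data FirstOrder {S : Set} (P : S → Set) : Ty S → Set where
  fo-base : ∀ {A} → P A → FirstOrder P (ι A)
  fo-arr  : ∀ {A B} → P A → FirstOrder P B → FirstOrder P (ι A ⇒ B)

record Signature : Set₁ where
  field
    Sort      : Set
    IsThSort  : Sort → Set
    Fun       : Set
    type      : Fun → Ty Sort
    IsThSym   : Fun → Set
    thSym-fo  : ∀ f → IsThSym f → FirstOrder IsThSort (type f)
    bool      : Sort
    bool-th   : IsThSort bool
    𝔱 𝔣       : Fun
    𝔱-th      : IsThSym 𝔱
    𝔣-th      : IsThSym 𝔣
    𝔱-type    : type 𝔱 ≡ ι bool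
    𝔣-type    : type 𝔣 ≡ ι bool

module _ (sig : Signature) where
  open Signature sig

  Type : Set
  Type = Ty Sort

  data Tm : Type → Set where
    var : (x : ℕ) (A : Type) → Tm A
    fun : (f : Fun) → Tm (type f)
    app : ∀ {A B} → Tm (A ⇒ B) → Tm A → Tm B

  Term : Set
  Term = Σ Type Tm

  data Occ (x : ℕ) (B : Type) : ∀ {A} → Tm A → Set where
    occ-var : Occ x B (var x B)
    occ-l   : ∀ {A C} {s : Tm (A ⇒ C)} {t : Tm A} → Occ x B s → Occ x B (app s t)
    occ-r   : ∀ {A C} {s : Tm (A ⇒ C)} {t : Tm A} → Occ x B t → Occ x B (app s t)

  data SymOcc (f : Fun) : ∀ {A} → Tm A → Set where
    sym-here : SymOcc f (fun f)
    sym-l    : ∀ {A C} {s : Tm (A ⇒ C)} {t : Tm A} → SymOcc f s → SymOcc f (app s t)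
    sym-r    : ∀ {A C} {s : Tm (A ⇒ C)} {t : Tm A} → SymOcc f t → SymOcc f (app s t)

  data Spine (f : Fun) : ∀ {A} → Tm A → List Term → Set where
    sp-fun : Spine f (fun f) []
    sp-app : ∀ {A C} {s : Tm (A ⇒ C)} {u : Tm A} {us} →
             Spine f s us → Spine f (app s u) (us ++ [ (A , u) ])

  data SymHeaded : ∀ {A} → Tm A → Set where
    sh-fun : ∀ {f} → SymHeaded (fun f)
    sh-app : ∀ {A C} {s : Tm (A ⇒ C)} {u : Tm A} → SymHeaded s → SymHeaded (app s u)

  data Neutral : ∀ {A} → Tm A → Set where
    ne-var : ∀ {x A} → Neutral (var x A)
    ne-app : ∀ {A C} {s : Tm (A ⇒ C)} {u : Tm A} → Neutral s → Neutral (app s u)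

  data IsPattern : ∀ {A} → Tm A → Set where
    p-var : ∀ {x A} → IsPattern (var x A)
    p-fun : ∀ {f} → IsPattern (fun f)
    p-app : ∀ {A C} {s : Tm (A ⇒ C)} {u : Tm A} →
            SymHeaded s → IsPattern s → IsPattern u → IsPattern (app s u)

  data IsTheoryTm : ∀ {A} → Tm A → Set where
    th-var : ∀ {x A} → IsTheoryTm (var x A)
    th-fun : ∀ {f} → IsThSym f → IsTheoryTm (fun f)
    th-app : ∀ {A C} {s : Tm (A ⇒ C)} {u : Tm A} →
             IsTheoryTm s → IsTheoryTm u → IsTheoryTm (app s u)

  data IsValue : ∀ {A} → Tm A → Set where
    isv : ∀ {f S} → IsThSym f → type f ≡ ι S → IsValue (fun f)

  data ValApp : ∀ {A} → Tm A → Set where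
    va-fun : ∀ {f} → IsThSym f → ValApp (fun f)
    va-app : ∀ {A C} {s : Tm (A ⇒ C)} {u : Tm A} → ValApp s → IsValue u → ValApp (app s u)

  ThSorted : Type → Set
  ThSorted (ι S)   = IsThSort S
  ThSorted (_ ⇒ _) = ⊥

  true false : Tm (ι bool)
  true  = subst Tm 𝔱-type (fun 𝔱)
  false = subst Tm 𝔣-type (fun 𝔣)

  Subst : Set
  Subst = (x : ℕ) (A : Type) → Tm A

  _⟨_⟩ : ∀ {A} → Tm A → Subst → Tm A
  var x A ⟨ σ ⟩ = σ x A
  fun f   ⟨ σ ⟩ = fun f
  app s t ⟨ σ ⟩ = app (s ⟨ σ ⟩) (t ⟨ σ ⟩)

  ⟦_⟧ty[_] : Type → (Sort → Set) → Set
  ⟦ ι S   ⟧ty[ X ] = X S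
  ⟦ A ⇒ B ⟧ty[ X ] = ⟦ A ⟧ty[ X ] → ⟦ B ⟧ty[ X ]

  data Eval (X : Sort → Set) (⟦_⟧ : (f : Fun) → IsThSym f → ⟦ type f ⟧ty[ X ])
       : ∀ {A} → Tm A → ⟦ A ⟧ty[ X ] → Set where
    ev-fun : ∀ {f} (p : IsThSym f) → Eval X ⟦_⟧ (fun f) (⟦ f ⟧ p)
    ev-app : ∀ {A C} {s : Tm (A ⇒ C)} {u : Tm A} {g a} →
             Eval X ⟦_⟧ s g → Eval X ⟦_⟧ u a → Eval X ⟦_⟧ (app s u) (g a)

  record Interpretation : Set₁ where
    field
      𝔛   : Sort → Set
      ⟦_⟧ : (f : Fun) → IsThSym f → ⟦ type f ⟧ty[ 𝔛 ]
      -- the interpretation is a bijection between values of sort A and 𝔛_A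
      values-inj  : ∀ {A} → IsThSort A → (s t : Tm (ι A)) → IsValue s → IsValue t →
                    ∀ a → Eval 𝔛 ⟦_⟧ s a → Eval 𝔛 ⟦_⟧ t a → s ≡ t
      values-surj : ∀ {A} → IsThSort A → (a : 𝔛 A) →
                    ∃[ v ] (IsValue v × Eval 𝔛 ⟦_⟧ v a)
      -- 𝔛_bool = {1, 0} with 𝔱 ↦ 1, 𝔣 ↦ 0
      𝔱≢𝔣        : 𝔱 ≢ 𝔣
      bool-values : (v : Tm (ι bool)) → IsValue v → v ≡ true ⊎ v ≡ false

  record Rule : Set where
    constructor mkRule
    field
      rty  : Type
      lhs  : Tm rty
      rhs  : Tm rty
      cond : Tm (ι bool)

  record WellFormedRule (ρ : Rule) : Set where
    open Rule ρ
    field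
      lhs-pattern   : IsPattern lhs
      lhs-headed    : SymHeaded lhs
      lhs-nonTheory : ∃[ f ] (SymOcc f lhs × ¬ IsThSym f)
      cond-theory   : IsTheoryTm cond
      cond-vars     : ∀ x B → Occ x B cond → ThSorted B
      fresh-vars    : ∀ x B → Occ x B rhs → ¬ Occ x B lhs → ThSorted B

  Defined : (Rule → Set) → Fun → Set
  Defined R f = ∃[ ρ ] (R ρ × ∃[ ts ] Spine f (Rule.lhs ρ) ts)

  record SortOrdering : Set₁ where
    field
      _≿_         : Sort → Sort → Set
      isQuasiOrder : IsPreorder _≡_ _≿_
      strict-wf   : WellFounded (λ B A → A ≿ B × ¬ (B ≿ A))

  module _ (O : SortOrdering) where
    open SortOrdering O

    _≻_ : Sort → Sort → Set
    A ≻ B = A ≿ B × ¬ (B ≿ A)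

    _≿₊_ : Sort → Type → Set
    _≻₋_ : Sort → Type → Set
    A ≿₊ ι C         = A ≿ C
    A ≿₊ (B₁ ⇒ B)   = A ≻₋ B₁ × A ≿₊ B
    A ≻₋ ι C         = A ≻ C
    A ≻₋ (B₁ ⇒ B)   = A ≿₊ B₁ × A ≻₋ B

    outSort : Type → Sort
    outSort (ι S)   = S
    outSort (_ ⇒ B) = outSort B

    -- the type of the k-th argument (0-indexed)
    argTy : Type → ℕ → Maybe Type
    argTy (ι _)   _       = nothing
    argTy (A ⇒ _) zero    = just A
    argTy (_ ⇒ B) (suc k) = argTy B k

    -- k ∈ Acc(f)  (argument positions counted from 0)
    AccPos : Fun → ℕ → Set
    AccPos f k = ∃[ A ] (argTy (type f) k ≡ just A × outSort (type f) ≿₊ A)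

  module _ (𝓘 : Interpretation) (R : Rule → Set) where
    open Interpretation 𝓘

    data _↦_ : ∀ {A} → Tm A → Tm A → Set where
      rule-step : ∀ ρ → R ρ → (σ : Subst) →
        (∀ x B → (Occ x B (Rule.cond ρ) ⊎ (Occ x B (Rule.rhs ρ) × ¬ Occ x B (Rule.lhs ρ))) →
                 IsValue (σ x B)) →
        (∃[ a ] (Eval 𝔛 ⟦_⟧ (Rule.cond ρ ⟨ σ ⟩) a × Eval 𝔛 ⟦_⟧ true a)) →
        (Rule.lhs ρ ⟨ σ ⟩) ↦ (Rule.rhs ρ ⟨ σ ⟩)
      calc-step : ∀ {A S} {s : Tm (A ⇒ ι S)} {u : Tm A} {v : Tm (ι S)} {a} →
        ValApp (app s u) → IsValue v →
        Eval 𝔛 ⟦_⟧ (app s u) a → Eval 𝔛 ⟦_⟧ v a → app s u ↦ v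

    data _⟶_ : ∀ {A} → Tm A → Tm A → Set where
      root : ∀ {A} {s t : Tm A} → s ↦ t → s ⟶ t
      appˡ : ∀ {A C} {s s' : Tm (A ⇒ C)} {u : Tm A} → s ⟶ s' → app s u ⟶ app s' u
      appʳ : ∀ {A C} {s : Tm (A ⇒ C)} {u u' : Tm A} → u ⟶ u' → app s u ⟶ app s u'

    TerminatingR : ∀ {A} → Tm A → Set
    TerminatingR {A} t = Acc {A = Tm A} (λ u v → v ⟶ u) t

    Fam : Set₁
    Fam = (S : Sort) → Tm (ι S) → Set

    record IsRCSet (I : Fam) : Set where
      field
        rc-terminating : ∀ {S} {t : Tm (ι S)} → I S t → TerminatingR t
        rc-closed      : ∀ {S} {t t' : Tm (ι S)} → I S t → t ⟶ t' → I S t'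
        rc-neutral     : ∀ {S} {t : Tm (ι S)} → Neutral t →
                         (∀ t' → t ⟶ t' → I S t') → I S t

    Computable : Fam → (A : Type) → Tm A → Set
    Computable I (ι S)   t = I S t
    Computable I (A ⇒ B) t = (u : Tm A) → Computable I A u → Computable I B (app t u)

    data AppliedTo (I : Fam) {A} (h : Tm A) : ∀ {B} → Tm B → Set where
      ap-none : AppliedTo I h h
      ap-more : ∀ {B C} {t : Tm (B ⇒ C)} {u : Tm B} →
                AppliedTo I h t → Computable I B u → AppliedTo I h (app t u)

    module _ (O : SortOrdering) (I : Fam) where

      data _⇛_ {S T : Sort} : Tm (ι S) → Tm (ι T) → Set where
        acc-step : ∀ {f} {s : Tm (ι S)} {t : Tm (ι T)} {ss : List Term} →
                   Spine f s ss → (k : Fin (length ss)) → AccPos O f (toℕ k) →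
                   AppliedTo I (proj₂ (lookup ss k)) t → s ⇛ t

      data Step : Term → Term → Set where
        st-R : ∀ {A} {s t : Tm A} → s ⟶ t → Step (A , s) (A , t)
        st-⇛ : ∀ {S T} {s : Tm (ι S)} {t : Tm (ι T)} → s ⇛ t → Step (ι S , s) (ι T , t)

      TerminatingR⇛ : ∀ {A} → Tm A → Set
      TerminatingR⇛ {A} t = Acc (λ u v → Step v u) (A , t)

      -- the defining property of ℂ (as a fixed-point equation on I)
      IsC : Set
      IsC = ∀ S (t : Tm (ι S)) →
        I S t ⇔ (TerminatingR⇛ t ×
                 (∀ t' → Star _⟶_ t t' → ∀ f ts → Spine f t' ts →
                   (k : Fin (length ts)) → AccPos O f (toℕ k) →
                   Computable I (proj₁ (lookup ts k)) (proj₂ (lookup ts k))))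

-- Let f be a symbol without rules. A reduct of f t₁ ⋯ tₙ is either again of
-- that shape, with one argument reduced (and computability is closed under
-- reduction), or — by a calculation step at the root — a value, which is a
-- normal form since every rule's left-hand side contains a non-theory symbol.
-- So f applied to computable (hence terminating) arguments terminates, its
-- accessible subterms stay computable along reductions, and a ⇛-step leads to
-- a computable, hence ℂ-terminating, term. By the defining property of ℂ every
-- such base-type application lies in ℂ, which is the computability of f.
module Submission where

open import Defs
open import Data.Fin using (Fin; toℕ)
open import Data.List using (List; []; length; lookup)
open import Data.List.Relation.Unary.All as All using (All; []; _∷_)
open import Data.List.Relation.Unary.All.Properties using (++⁺)
open import Data.List.Membership.Propositional.Properties using (∈-lookup)
open import Data.Product using (_,_; ∃; ∃₂; proj₁)
open import Data.Sum using (_⊎_; inj₁; inj₂)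
open import Data.Empty using (⊥-elim)
open import Relation.Nullary using (¬_)
open import Relation.Binary.PropositionalEquality using (_≡_; refl)
open import Relation.Binary.Construct.Closure.ReflexiveTransitive using (Star; ε; _◅_)
open import Induction.WellFounded using (acc)
open import Function.Bundles using (Equivalence)

module _ {Sig : Signature} where
  open Signature Sig

  private variable
    A B : Type Sig
    g : Fun
    ts : List (Term Sig)
    l t : Tm Sig A
    σ : Subst Sig

  symHeaded⇒spine : SymHeaded Sig t → ∃₂ λ g ts → Spine Sig g t ts
  symHeaded⇒spine sh-fun = _ , [] , sp-fun
  symHeaded⇒spine (sh-app h) with symHeaded⇒spine h
  ... | g , ts , sp = g , _ , sp-app sp

  symHeaded-subst-¬neutral : SymHeaded Sig l → ¬ Neutral Sig (_⟨_⟩ Sig l σ)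
  symHeaded-subst-¬neutral (sh-app h) (ne-app n) = symHeaded-subst-¬neutral h n

  valApp-¬neutral : ValApp Sig t → ¬ Neutral Sig t
  valApp-¬neutral (va-app v _) (ne-app n) = valApp-¬neutral v n

  value-sort : IsValue Sig {A} t → ∃ λ S → A ≡ ι S
  value-sort (isv _ e) = _ , e

  value-¬arrow : ¬ IsValue Sig {A ⇒ B} t
  value-¬arrow v with value-sort v
  ... | _ , ()

  value-¬app : {s : Tm Sig (A ⇒ B)} {u : Tm Sig A} → ¬ IsValue Sig (app s u)
  value-¬app ()

  value-subst-occ-theory : SymHeaded Sig l → IsValue Sig (_⟨_⟩ Sig l σ) →
                           SymOcc Sig g l → IsThSym g
  value-subst-occ-theory sh-fun (isv th _) sym-here = th
  value-subst-occ-theory (sh-app _) v _ = ⊥-elim (value-¬app v)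

  module _ (𝓘 : Interpretation Sig) (R : Rule Sig → Set)
           (wf : ∀ ρ → R ρ → WellFormedRule Sig ρ) where
    open WellFormedRule

    private variable
      s s' : Tm Sig (A ⇒ B)
      u t' : Tm Sig A

    neutral-¬rootStep : Neutral Sig t → ¬ _↦_ Sig 𝓘 R t t'
    neutral-¬rootStep n (rule-step ρ Rρ σ _ _) = symHeaded-subst-¬neutral (lhs-headed (wf ρ Rρ)) n
    neutral-¬rootStep n (calc-step va _ _ _)   = valApp-¬neutral va n

    var-normal : ∀ {x} → ¬ _⟶_ Sig 𝓘 R (var x A) t'
    var-normal (root st) = neutral-¬rootStep ne-var st

    value-normal : IsValue Sig t → ¬ _⟶_ Sig 𝓘 R t t'
    value-normal v (root (rule-step ρ Rρ σ _ _)) with lhs-nonTheory (wf ρ Rρ)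
    ... | g , occ , ¬th = ¬th (value-subst-occ-theory (lhs-headed (wf ρ Rρ)) v occ)
    value-normal v (root (calc-step _ _ _ _)) = value-¬app v
    value-normal v (appˡ _) = value-¬app v
    value-normal v (appʳ _) = value-¬app v

    value-terminating : IsValue Sig t → TerminatingR Sig 𝓘 R t
    value-terminating v = acc λ st → ⊥-elim (value-normal v st)

    terminating-appˡ : TerminatingR Sig 𝓘 R (app s u) → TerminatingR Sig 𝓘 R s
    terminating-appˡ (acc rs) = acc λ st → terminating-appˡ (rs (appˡ st))

    module _ (ℂ : Fam Sig 𝓘 R) (rc : IsRCSet Sig 𝓘 R ℂ) where
      open IsRCSet rc

      computable-⟶ : ∀ A {t t' : Tm Sig A} → Computable Sig 𝓘 R ℂ A t → _⟶_ Sig 𝓘 R t t' →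
                     Computable Sig 𝓘 R ℂ A t'
      computable-⟶ (ι S)   c st = rc-closed c st
      computable-⟶ (A ⇒ B) c st u cu = computable-⟶ B (c u cu) (appˡ st)

      ComputableTerm : Term Sig → Set
      ComputableTerm (A , u) = Computable Sig 𝓘 R ℂ A u

      computable-terminating : ∀ A {t : Tm Sig A} → Computable Sig 𝓘 R ℂ A t → TerminatingR Sig 𝓘 R t
      neutral-computable : ∀ A {t : Tm Sig A} → Neutral Sig t →
                           (∀ t' → _⟶_ Sig 𝓘 R t t' → Computable Sig 𝓘 R ℂ A t') →
                           Computable Sig 𝓘 R ℂ A t

      computable-terminating (ι S)   c = rc-terminating c
      computable-terminating (A ⇒ B) c =
        terminating-appˡ (computable-terminating B (c (var 0 A) var-computable))
        where
        var-computable : Computable Sig 𝓘 R ℂ A (var 0 A)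
        var-computable = neutral-computable A ne-var λ _ st → ⊥-elim (var-normal st)

      neutral-computable (ι S)   n reducts-computable = rc-neutral n reducts-computable
      neutral-computable (A ⇒ B) {t} n reducts-computable u cu =
        neutral-app-computable cu (computable-terminating A cu)
        where
        neutral-app-computable : ∀ {u} → Computable Sig 𝓘 R ℂ A u → TerminatingR Sig 𝓘 R u →
                                 Computable Sig 𝓘 R ℂ B (app t u)
        neutral-app-computable {u} cu (acc rs) = neutral-computable B (ne-app n) λ
          { _ (root st) → ⊥-elim (neutral-¬rootStep (ne-app n) st)
          ; _ (appˡ st) → reducts-computable _ st u cu
          ; _ (appʳ st) → neutral-app-computable (computable-⟶ A cu st) (rs st) }

      computable-appliedTo : {h : Tm Sig A} → Computable Sig 𝓘 R ℂ A h →
                           AppliedTo Sig 𝓘 R ℂ h t → Computable Sig 𝓘 R ℂ B t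
      computable-appliedTo c ap-none        = c
      computable-appliedTo c (ap-more ap cu) = computable-appliedTo c ap _ cu

      module _ (f : Fun) (undefined : ¬ Defined Sig R f) where

        Applied : Tm Sig A → Set
        Applied = AppliedTo Sig 𝓘 R ℂ (fun f)

        spine-applied-head : Spine Sig g l ts → Applied (_⟨_⟩ Sig l σ) → g ≡ f
        spine-applied-head sp-fun      ap-none        = refl
        spine-applied-head (sp-app sp) (ap-more ap _) = spine-applied-head sp ap

        applied-rootStep-value : Applied t → _↦_ Sig 𝓘 R t t' → IsValue Sig t'
        applied-rootStep-value ap (rule-step ρ Rρ σ _ _)
          with symHeaded⇒spine (lhs-headed (wf ρ Rρ))
        ... | g , ts , sp with spine-applied-head sp ap
        ... | refl = ⊥-elim (undefined (ρ , Rρ , ts , sp))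
        applied-rootStep-value _ (calc-step _ v _ _) = v

        applied-step : Applied t → _⟶_ Sig 𝓘 R t t' → Applied t' ⊎ IsValue Sig t'
        applied-arrow-step : Applied s → _⟶_ Sig 𝓘 R s s' → Applied s'

        applied-step ap (root st) = inj₂ (applied-rootStep-value ap st)
        applied-step (ap-more ap cu) (appˡ st) = inj₁ (ap-more (applied-arrow-step ap st) cu)
        applied-step (ap-more ap cu) (appʳ st) = inj₁ (ap-more ap (computable-⟶ _ cu st))

        applied-arrow-step ap st with applied-step ap st
        ... | inj₁ ap' = ap'
        ... | inj₂ v   = ⊥-elim (value-¬arrow v)

        applied-steps : Applied t ⊎ IsValue Sig t → Star (_⟶_ Sig 𝓘 R) t t' →
                        Applied t' ⊎ IsValue Sig t'
        applied-steps x        ε          = x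
        applied-steps (inj₁ ap) (st ◅ sts) = applied-steps (applied-step ap st) sts
        applied-steps (inj₂ v)  (st ◅ _)   = ⊥-elim (value-normal v st)

        applied-app-terminating : Applied s → Computable Sig 𝓘 R ℂ A u →
                                  TerminatingR Sig 𝓘 R s → TerminatingR Sig 𝓘 R u →
                                  TerminatingR Sig 𝓘 R (app s u)
        applied-app-terminating ap cu (acc rs) (acc ru) = acc λ
          { (root st) → value-terminating (applied-rootStep-value (ap-more ap cu) st)
          ; (appˡ st) → applied-app-terminating (applied-arrow-step ap st) cu (rs st) (acc ru)
          ; (appʳ st) → applied-app-terminating ap (computable-⟶ _ cu st) (acc rs) (ru st) }

        applied-terminating : Applied t → TerminatingR Sig 𝓘 R t
        applied-terminating ap-none = acc λ
          { (root st) → value-terminating (applied-rootStep-value ap-none st) }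
        applied-terminating (ap-more ap cu) =
          applied-app-terminating ap cu (applied-terminating ap) (computable-terminating _ cu)

        applied-spine-computable : Applied t → Spine Sig g t ts → All ComputableTerm ts
        applied-spine-computable ap-none         sp-fun      = []
        applied-spine-computable (ap-more ap cu) (sp-app sp) =
          ++⁺ (applied-spine-computable ap sp) (cu ∷ [])

        applied-spine-lookup-computable : Applied t → Spine Sig g t ts →
                                          (k : Fin (length ts)) → ComputableTerm (lookup ts k)
        applied-spine-lookup-computable ap sp k =
          All.lookup (applied-spine-computable ap sp) (∈-lookup k)

        value-spine-¬position : IsValue Sig t → Spine Sig g t ts → ¬ Fin (length ts)
        value-spine-¬position (isv _ _) sp-fun ()

        module _ (O : SortOrdering Sig) (isC : IsC Sig 𝓘 R O ℂ) where

          ℂ-terminating⇛ : ∀ {S} {t : Tm Sig (ι S)} → ℂ S t → TerminatingR⇛ Sig 𝓘 R O ℂ t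
          ℂ-terminating⇛ c = proj₁ (Equivalence.to (isC _ _) c)

          value-terminating⇛ : ∀ {S} {t : Tm Sig (ι S)} → IsValue Sig t →
                               TerminatingR⇛ Sig 𝓘 R O ℂ t
          value-terminating⇛ v = acc λ
            { (st-R st) → ⊥-elim (value-normal v st)
            ; (st-⇛ (acc-step sp k _ _)) → ⊥-elim (value-spine-¬position v sp k) }

          applied-terminating⇛ : ∀ {S} {t : Tm Sig (ι S)} → Applied t →
                                 TerminatingR Sig 𝓘 R t → TerminatingR⇛ Sig 𝓘 R O ℂ t
          applied-terminating⇛ ap (acc rs) = acc λ
            { (st-R st) → reduct-terminating⇛ (applied-step ap st) (rs st)
            ; (st-⇛ (acc-step sp k _ ap')) →
                ℂ-terminating⇛ (computable-appliedTo (applied-spine-lookup-computable ap sp k) ap') }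
            where
            reduct-terminating⇛ : ∀ {S} {t : Tm Sig (ι S)} → Applied t ⊎ IsValue Sig t →
                                  TerminatingR Sig 𝓘 R t → TerminatingR⇛ Sig 𝓘 R O ℂ t
            reduct-terminating⇛ (inj₁ ap) = applied-terminating⇛ ap
            reduct-terminating⇛ (inj₂ v)  = λ _ → value-terminating⇛ v

          applied-computable : ∀ A {t : Tm Sig A} → Applied t → Computable Sig 𝓘 R ℂ A t
          applied-computable (A ⇒ B) ap u cu = applied-computable B (ap-more ap cu)
          applied-computable (ι S) {t} ap = Equivalence.from (isC S t)
            (applied-terminating⇛ ap (applied-terminating ap) , accessible-computable)
            where
            accessible-computable : ∀ t' → Star (_⟶_ Sig 𝓘 R) t t' → ∀ g ts → Spine Sig g t' ts →
                                    (k : Fin (length ts)) → AccPos Sig O g (toℕ k) →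
                                    ComputableTerm (lookup ts k)
            accessible-computable t' steps g ts sp k _ with applied-steps (inj₁ ap) steps
            ... | inj₁ ap' = applied-spine-lookup-computable ap' sp k
            ... | inj₂ v   = ⊥-elim (value-spine-¬position v sp k)

lemma47 : (Σ : Signature) (𝓘 : Interpretation Σ) (R : Rule Σ → Set)
          → (∀ ρ → R ρ → WellFormedRule Σ ρ)
          → (O : SortOrdering Σ) (ℂ : Fam Σ 𝓘 R)
          → IsRCSet Σ 𝓘 R ℂ
          → IsC Σ 𝓘 R O ℂ
          → (f : Signature.Fun Σ) → ¬ Defined Σ R f
          → Computable Σ 𝓘 R ℂ (Signature.type Σ f) (fun {sig = Σ} f)
lemma47 Σ 𝓘 R wf O ℂ rc isC f undefined =
  applied-computable 𝓘 R wf ℂ rc f undefined O isC (Signature.type Σ f) ap-none
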